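{- Let $\mathcal{I}$ be a Stable Marriage instance belonging to the family $F$, and let $\Pi_F$ be its rotation poset. Let $P_1$ and $P_2$ be two different directed paths in $\Pi_F$, both starting at a rotation $\rho_s$ and ending at a rotation $\rho_t$, and let $(m_e,w_f)$ be a pair belonging to $\rho_s$. If every rotation on $P_1$ (respectively $P_2$) contains the man $m_e$, then at least one rotation on $P_2$ (respectively $P_1$) does not contain the woman $w_f$.
   Context: A Stable Marriage instance (with incomplete lists) consists of $n$ men $m_1,\dots,m_n$ and $n$ women $w_1,\dots,w_n$, each with a strict ordinal preference list over some members of the opposite sex. A pair $(m_i,w_j)$ is acceptable if each appears in the other's list. A matching is a set of acceptable pairs in which each person appears at most once; $M(m_i)$ denotes the partner of $m_i$. A pair $(m_i,w_j)$ blocks $M$ if $m_i$ prefers $w_j$ to $M(m_i)$ and $w_j$ prefers $m_i$ to $M(w_j)$; $M$ is stable if it has no blocking pair. A pair is stable if it belongs to some stable matching; it is fixed (and its man and woman are fixed) if it belongs to every stable matching. $M_0$ denotes the man-optimal stable matching. Given a stable matching $M$, a rotation $\rho=((m_{k_0},w_{k_0}),\dots,(m_{k_{l-1}},w_{k_{l-1}}))$ is an ordered list of pairs of $M$ such that reassigning each $m_{k_i}$ to $w_{k_{i+1}}$ (indices mod $l$) yields a stable matching $M/\rho$; the pairs $(m_{k_i},w_{k_i})$ are eliminated by $\rho$ and the pairs $(m_{k_i},w_{k_{i+1}})$ are produced by $\rho$. A person is involved in (contained in) $\rho$ if he/she appears in one of its pairs. A rotation $\rho'$ precedes $\rho$ if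 $\rho'$ is eliminated in every sequence of rotation eliminations starting at $M_0$ and ending at a stable matching on which $\rho$ is exposed. The rotation poset is the directed graph whose vertices are the rotations, with an edge $(\rho',\rho)$ of type 1 whenever $(m_i,w_j)\in\rho$ and $\rho'$ is the unique rotation producing $(m_i,w_j)$, and an edge $(\rho',\rho)$ of type 2 whenever $\rho$ moves $m_i$ below $w_j$ and $\rho'\neq\rho$ is the unique rotation moving $w_j$ above $m_i$. Predecessors/successors of a rotation are its in-/out-neighbours in this graph. The family $F$ consists of the instances whose rotation poset $\Pi_F=(\mathcal{V}_F,E_F)$ satisfies: (1) every rotation contains exactly 2 pairs; (2) every rotation has at most 2 predecessors and at most 2 successors; (3) every edge of $E_F$ is of type 1; (4) every non-fixed man is involved in at least 2 rotations. -}

module Defs where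

open import Data.Nat using (ℕ; zero; suc; _≤_)
open import Data.Fin using (Fin)
open import Data.Maybe using (Maybe; just; nothing)
open import Data.Product using (Σ; ∃; ∃-syntax; _×_; _,_; proj₁; proj₂)
open import Data.Sum using (_⊎_)
open import Data.Unit using (⊤)
open import Data.List using (List; []; _∷_; _++_; [_]; map; zip; length)
open import Data.List.Membership.Propositional using (_∈_)
open import Data.List.Relation.Unary.All using (All)
open import Data.List.Relation.Unary.Unique.Propositional using (Unique)
open import Data.List.Relation.Binary.Pointwise using (Pointwise)
open import Relation.Nullary using (¬_)
open import Relation.Binary.PropositionalEquality using (_≡_)

Before : {A : Set} → List A → A → A → Set
Before l a b = ∃[ xs ] ∃[ ys ] (l ≡ xs ++ a ∷ ys × b ∈ ys)

rot1 : {A : Set} → List A → List A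
rot1 []       = []
rot1 (x ∷ xs) = xs ++ [ x ]

shift : {A : Set} → ℕ → List A → List A
shift zero    l = l
shift (suc k) l = shift k (rot1 l)

record Instance (n : ℕ) : Set where
  field
    mpref : Fin n → List (Fin n)     -- man i's list of women, best first
    wpref : Fin n → List (Fin n)     -- woman j's list of men, best first
    mUniq : ∀ i → Unique (mpref i)
    wUniq : ∀ j → Unique (wpref j)

module _ {n : ℕ} (I : Instance n) where
  open Instance I

  Man   = Fin n
  Woman = Fin n
  Pair  = Man × Woman

  Acceptable : Man → Woman → Set
  Acceptable m w = w ∈ mpref m × m ∈ wpref w

  -- a matching: partner of each man (nothing = unmatched)
  Matching : Set
  Matching = Man → Maybe Woman

  IsMatching : Matching → Set
  IsMatching M =
    (∀ m w → M m ≡ just w → Acceptable m w) ×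
    (∀ m m' w → M m ≡ just w → M m' ≡ just w → m ≡ m')

  MPrefers : Man → Woman → Maybe Woman → Set
  MPrefers m w nothing   = ⊤
  MPrefers m w (just w') = Before (mpref m) w w'

  -- w prefers m to her partner in M (vacuous if she is unmatched)
  WPrefers : Matching → Woman → Man → Set
  WPrefers M w m = ∀ m' → M m' ≡ just w → Before (wpref w) m m'

  Blocking : Matching → Man → Woman → Set
  Blocking M m w = Acceptable m w × MPrefers m w (M m) × WPrefers M w m

  Stable : Matching → Set
  Stable M = IsMatching M × (∀ m w → ¬ Blocking M m w)

  -- s_M(m) = w : w is the first woman strictly after M(m) on m's list
  -- who (finds m acceptable and) prefers m to her partner in M
  NextWoman : Matching → Man → Woman → Set
  NextWoman M m w =
    ∃[ w₀ ] ∃[ xs ] ∃[ us ] ∃[ vs ]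
      ( M m ≡ just w₀
      × mpref m ≡ xs ++ w₀ ∷ (us ++ w ∷ vs)
      × (m ∈ wpref w × WPrefers M w m)
      × All (λ u → ¬ (m ∈ wpref u × WPrefers M u m)) us )

  -- Rotations: a rotation is a cyclic list of pairs
  -- ((m₀,w₀),…,(m_{l-1},w_{l-1})); it produces (mᵢ , w_{i+1 mod l}).

  Rot : Set
  Rot = List Pair

  men : Rot → List Man
  men ρ = map proj₁ ρ

  women : Rot → List Woman
  women ρ = map proj₂ ρ

  produced : Rot → List Pair
  produced ρ = zip (men ρ) (rot1 (women ρ))

  Produces : Rot → Pair → Set
  Produces ρ p = p ∈ produced ρ

  Exposed : Matching → Rot → Set
  Exposed M ρ =
    2 ≤ length ρ
    × Unique (men ρ)
    × All (λ p → M (proj₁ p) ≡ just (proj₂ p)) ρ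
    × All (λ p → NextWoman M (proj₁ p) (proj₂ p)) (produced ρ)

  IsRotation : Rot → Set
  IsRotation ρ = ∃[ M ] (Stable M × Exposed M ρ)

  -- the same rotation (same cyclic list up to choice of starting pair)
  SameRot : Rot → Rot → Set
  SameRot ρ ρ' = ∃[ k ] (ρ' ≡ shift k ρ)

  ContainsMan : Man → Rot → Set
  ContainsMan m ρ = m ∈ men ρ

  ContainsWoman : Woman → Rot → Set
  ContainsWoman w ρ = w ∈ women ρ

  UniqueRot : (Rot → Set) → Rot → Set
  UniqueRot P ρ' = IsRotation ρ' × P ρ' × (∀ r → IsRotation r → P r → SameRot r ρ')

  MovesBelow : Rot → Man → Woman → Set
  MovesBelow ρ m w = ∃[ wo ] ∃[ wn ]
    ( (m , wo) ∈ ρ × (m , wn) ∈ produced ρ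
    × (wo ≡ w ⊎ Before (mpref m) wo w) × Before (mpref m) w wn )

  MovesAbove : Rot → Woman → Man → Set
  MovesAbove ρ w m = ∃[ mo ] ∃[ mn ]
    ( (mo , w) ∈ ρ × (mn , w) ∈ produced ρ
    × (mo ≡ m ⊎ Before (wpref w) m mo) × Before (wpref w) mn m )

  EdgeType1 : Rot → Rot → Set
  EdgeType1 ρ' ρ = ∃[ p ] (p ∈ ρ × UniqueRot (λ r → Produces r p) ρ')

  EdgeType2 : Rot → Rot → Set
  EdgeType2 ρ' ρ = ∃[ m ] ∃[ w ]
    (MovesBelow ρ m w × ¬ SameRot ρ' ρ × UniqueRot (λ r → MovesAbove r w m) ρ')

  Edge : Rot → Rot → Set
  Edge ρ' ρ = IsRotation ρ' × IsRotation ρ × (EdgeType1 ρ' ρ ⊎ EdgeType2 ρ' ρ)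

  FixedMan : Man → Set
  FixedMan m = ∃[ w ] (∀ M → Stable M → M m ≡ just w)

  data DPath : Rot → Rot → List Rot → Set where
    here : ∀ {ρ} → IsRotation ρ → DPath ρ ρ (ρ ∷ [])
    step : ∀ {ρ ρ' ρt vs} → Edge ρ ρ' → DPath ρ' ρt vs → DPath ρ ρt (ρ ∷ vs)

  DifferentPaths : List Rot → List Rot → Set
  DifferentPaths vs vs' = ¬ Pointwise SameRot vs vs'

  InF : Set
  InF =
    (∀ ρ → IsRotation ρ → length ρ ≡ 2)
    × (∀ ρ → IsRotation ρ → ∀ a b c → Edge a ρ → Edge b ρ → Edge c ρ →
         SameRot a b ⊎ SameRot a c ⊎ SameRot b c)
    × (∀ ρ → IsRotation ρ → ∀ a b c → Edge ρ a → Edge ρ b → Edge ρ c →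
         SameRot a b ⊎ SameRot a c ⊎ SameRot b c)
    × (∀ ρ' ρ → Edge ρ' ρ → EdgeType1 ρ' ρ)
    × (∀ m → ¬ FixedMan m →
         ∃[ ρ₁ ] ∃[ ρ₂ ] (IsRotation ρ₁ × IsRotation ρ₂ × ¬ SameRot ρ₁ ρ₂
                         × ContainsMan m ρ₁ × ContainsMan m ρ₂))

-- Along an edge ρ → ρ′ of type 1, ρ′ contains a pair produced by ρ. When rotations have
-- two pairs, this forces a man lying in both ρ and ρ′ to be strictly worse off in ρ′ than
-- in ρ, and a woman lying in both to be strictly better off. Hence if (mₑ , w_f) ∈ ρₛ, mₑ
-- lies on every rotation of P₁ and w_f on every rotation of P₂, then in ρₜ the man mₑ holds
-- some woman x he prefers less than w_f, while w_f holds some man y she prefers to mₑ. So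
-- ρₜ produces (mₑ , w_f), i.e. w_f is the woman after x on mₑ's list: contradiction.
-- If one path is trivial the same comparison takes place inside ρₛ itself.
module Submission where

open import Defs
open import Data.Nat using (ℕ)
open import Data.Fin using (Fin; _≟_)
open import Data.Product using (_×_; _,_; ∃-syntax)
open import Data.Sum using (_⊎_; inj₁; inj₂)
open import Data.Empty using (⊥-elim)
open import Data.Maybe using (just)
open import Data.Maybe.Properties using (just-injective)
open import Data.List using (List; []; _∷_; _++_; length)
open import Data.List.Properties using (∷-injectiveʳ; ++-assoc)
open import Data.List.Membership.Propositional using (_∈_)
open import Data.List.Membership.Propositional.Properties using (∈-++⁺ʳ; ∈-∃++; ∈-map⁻)
open import Data.List.Relation.Unary.All as All using (All; []; _∷_)
open import Data.List.Relation.Unary.All.Properties using (¬All⇒Any¬)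
open import Data.List.Relation.Unary.Any using (Any; here; there)
open import Data.List.Relation.Unary.Unique.Propositional using (Unique; _∷_)
open import Data.List.Relation.Unary.Unique.Propositional.Properties using (Unique[x∷xs]⇒x∉xs)
open import Data.List.Relation.Binary.Pointwise as Pointwise using (Pointwise)
open import Relation.Nullary using (¬_)
open import Relation.Binary.PropositionalEquality using (_≡_; _≢_; refl; sym; trans; subst)

module _ {A : Set} where

  Unique-suffix : ∀ (xs : List A) {ys} → Unique (xs ++ ys) → Unique ys
  Unique-suffix []       u       = u
  Unique-suffix (_ ∷ xs) (_ ∷ u) = Unique-suffix xs u

  Unique-suffix-after : ∀ (xs xs′ : List A) {a ys ys′} → Unique (xs ++ a ∷ ys) →
                        xs ++ a ∷ ys ≡ xs′ ++ a ∷ ys′ → ys ≡ ys′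
  Unique-suffix-after []       []         _         eq   = ∷-injectiveʳ eq
  Unique-suffix-after []       (_ ∷ xs′) (a∉ ∷ _) refl = ⊥-elim (All.lookup a∉ (∈-++⁺ʳ xs′ (here refl)) refl)
  Unique-suffix-after (_ ∷ xs) []         (a∉ ∷ _) refl = ⊥-elim (All.lookup a∉ (∈-++⁺ʳ xs (here refl)) refl)
  Unique-suffix-after (_ ∷ xs) (_ ∷ xs′) (_ ∷ u)  eq   = Unique-suffix-after xs xs′ u (∷-injectiveʳ eq)

  Before-irrefl : ∀ {l : List A} {a} → Unique l → ¬ Before l a a
  Before-irrefl u (xs , ys , refl , a∈ys) = Unique[x∷xs]⇒x∉xs (Unique-suffix xs u) a∈ys

  Before-trans : ∀ {l : List A} {a b c} → Unique l → Before l a b → Before l b c → Before l a c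
  Before-trans {a = a} {b} {c} u (xs , ys , refl , b∈ys) (xs′ , ys′ , eq′ , c∈ys′)
    with ps , qs , refl ← ∈-∃++ b∈ys =
    xs , ps ++ b ∷ qs , refl , ∈-++⁺ʳ ps (there (subst (c ∈_) (sym qs≡ys′) c∈ys′))
    where
      qs≡ys′ : qs ≡ ys′
      qs≡ys′ = Unique-suffix-after (xs ++ a ∷ ps) xs′
                 (subst Unique (sym assoc) u) (trans assoc eq′)
        where assoc = ++-assoc xs (a ∷ ps) (b ∷ qs)

  Before-asym : ∀ {l : List A} {a b} → Unique l → Before l a b → ¬ Before l b a
  Before-asym u a<b b<a = Before-irrefl u (Before-trans u a<b b<a)

module Rotations {n : ℕ} (I : Instance n) where
  open Instance I

  ∈-men⁻ : ∀ {m ρ} → ContainsMan I m ρ → ∃[ w ] ((m , w) ∈ ρ)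
  ∈-men⁻ m∈ with (_ , w) , mw , refl ← ∈-map⁻ _ m∈ = w , mw

  ∈-women⁻ : ∀ {w ρ} → ContainsWoman I w ρ → ∃[ m ] ((m , w) ∈ ρ)
  ∈-women⁻ w∈ with (m , _) , mw , refl ← ∈-map⁻ _ w∈ = m , mw

  produced-meets : ∀ {ρ : Rot I} → length ρ ≡ 2 → ∀ {m w m′ w′} →
                   (m , w) ∈ ρ → (m′ , w′) ∈ produced I ρ → m′ ≡ m ⊎ w′ ≡ w
  produced-meets {_ ∷ _ ∷ []} _ (here refl)         (here refl)         = inj₁ refl
  produced-meets {_ ∷ _ ∷ []} _ (here refl)         (there (here refl)) = inj₂ refl
  produced-meets {_ ∷ _ ∷ []} _ (there (here refl)) (here refl)         = inj₂ refl
  produced-meets {_ ∷ _ ∷ []} _ (there (here refl)) (there (here refl)) = inj₁ refl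

  produced-cross : ∀ {ρ : Rot I} → length ρ ≡ 2 → ∀ {m w m′ w′} →
                   (m , w) ∈ ρ → (m′ , w′) ∈ ρ → m ≢ m′ → (m , w′) ∈ produced I ρ
  produced-cross {_ ∷ _ ∷ []} _ (here refl)         (here refl)         m≢m′ = ⊥-elim (m≢m′ refl)
  produced-cross {_ ∷ _ ∷ []} _ (here refl)         (there (here refl)) _    = here refl
  produced-cross {_ ∷ _ ∷ []} _ (there (here refl)) (here refl)         _    = there (here refl)
  produced-cross {_ ∷ _ ∷ []} _ (there (here refl)) (there (here refl)) m≢m′ = ⊥-elim (m≢m′ refl)

  module _ {M : Matching I} {ρ : Rot I} (exposed : Exposed I M ρ) where

    Exposed⇒matched : ∀ {m w} → (m , w) ∈ ρ → M m ≡ just w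
    Exposed⇒matched = All.lookup (let (_ , _ , matched , _) = exposed in matched)

    Exposed⇒next : ∀ {m w} → (m , w) ∈ produced I ρ → NextWoman I M m w
    Exposed⇒next = All.lookup (let (_ , _ , _ , next) = exposed in next)

    man-worsens : ∀ {m w w′} → (m , w) ∈ ρ → (m , w′) ∈ produced I ρ → Before (mpref m) w w′
    man-worsens {w′ = w′} mw mw′
      with w₀ , xs , us , vs , M≡w₀ , pref≡ , _ ← Exposed⇒next mw′
      with refl ← just-injective (trans (sym M≡w₀) (Exposed⇒matched mw))
      = xs , us ++ w′ ∷ vs , pref≡ , ∈-++⁺ʳ us (here refl)

    woman-improves : ∀ {m m′ w} → (m , w) ∈ ρ → (m′ , w) ∈ produced I ρ → Before (wpref w) m′ m
    woman-improves mw m′w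
      with _ , _ , _ , _ , _ , _ , (_ , prefers) , _ ← Exposed⇒next m′w
      = prefers _ (Exposed⇒matched mw)

  DPath-end : ∀ {ρ ρt vs} → DPath I ρ ρt vs → IsRotation I ρt
  DPath-end (here r)   = r
  DPath-end (step _ p) = DPath-end p

module TwoPairRotations {n : ℕ} (I : Instance n)
  (two-pairs : ∀ ρ → IsRotation I ρ → length ρ ≡ 2)
  (type1 : ∀ ρ ρ′ → Edge I ρ ρ′ → EdgeType1 I ρ ρ′) where
  open Instance I
  open Rotations I

  man-worsens-across : ∀ {ρ ρ′ me a} → Edge I ρ ρ′ → (me , a) ∈ ρ → ContainsMan I me ρ′ →
                       ∃[ x ] ((me , x) ∈ ρ′ × Before (mpref me) a x)
  man-worsens-across {ρ} {ρ′} {me} {a} e@(r@(_ , _ , ex) , r′@(_ , _ , ex′) , _) ma me∈ρ′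
    with (m′ , w′) , p∈ρ′ , (_ , p∈ρ , _) ← type1 _ _ e
    with z , mez ← ∈-men⁻ me∈ρ′
    with produced-meets (two-pairs ρ r) ma p∈ρ
  ... | inj₁ refl = w′ , p∈ρ′ , man-worsens ex ma p∈ρ
  -- Otherwise ρ′ contains (m′ , a), and both ρ and ρ′ improve a: from me to m′ and back.
  ... | inj₂ refl = ⊥-elim (Before-asym (wUniq a) m′<me me<m′)
    where
      m′<me : Before (wpref a) m′ me
      m′<me = woman-improves ex ma p∈ρ
      me≢m′ : me ≢ m′
      me≢m′ refl = Before-irrefl (wUniq a) m′<me
      me<m′ : Before (wpref a) me m′
      me<m′ = woman-improves ex′ p∈ρ′ (produced-cross (two-pairs ρ′ r′) mez p∈ρ′ me≢m′)

  woman-improves-across : ∀ {ρ ρ′ b wf} → Edge I ρ ρ′ → (b , wf) ∈ ρ → ContainsWoman I wf ρ′ →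
                          ∃[ y ] ((y , wf) ∈ ρ′ × Before (wpref wf) y b)
  woman-improves-across {ρ} {ρ′} {b} {wf} e@(r@(_ , _ , ex) , r′@(_ , _ , ex′) , _) bw wf∈ρ′
    with (m′ , w′) , p∈ρ′ , (_ , p∈ρ , _) ← type1 _ _ e
    with z , zwf ← ∈-women⁻ wf∈ρ′
    with produced-meets (two-pairs ρ r) bw p∈ρ
  ... | inj₂ refl = m′ , p∈ρ′ , woman-improves ex bw p∈ρ
  ... | inj₁ refl = ⊥-elim (Before-asym (mUniq b) wf<w′ w′<wf)
    where
      wf<w′ : Before (mpref b) wf w′
      wf<w′ = man-worsens ex bw p∈ρ
      b≢z : b ≢ z
      b≢z refl with refl ← just-injective (trans (sym (Exposed⇒matched ex′ zwf)) (Exposed⇒matched ex′ p∈ρ′))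
        = Before-irrefl (mUniq b) wf<w′
      w′<wf : Before (mpref b) w′ wf
      w′<wf = man-worsens ex′ p∈ρ′ (produced-cross (two-pairs ρ′ r′) p∈ρ′ zwf b≢z)

  man-worsens-along : ∀ {ρ ρ′ ρt vs me a} → Edge I ρ ρ′ → DPath I ρ′ ρt vs →
                      All (ContainsMan I me) vs → (me , a) ∈ ρ →
                      ∃[ x ] ((me , x) ∈ ρt × Before (mpref me) a x)
  man-worsens-along e (here _) (me∈ρ′ ∷ []) ma = man-worsens-across e ma me∈ρ′
  man-worsens-along {me = me} e (step e′ p) (me∈ρ′ ∷ me∈vs) ma
    with x , mx , a<x ← man-worsens-across e ma me∈ρ′
    with y , my , x<y ← man-worsens-along e′ p me∈vs mx
    = y , my , Before-trans (mUniq me) a<x x<y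

  woman-improves-along : ∀ {ρ ρ′ ρt vs wf b} → Edge I ρ ρ′ → DPath I ρ′ ρt vs →
                         All (ContainsWoman I wf) vs → (b , wf) ∈ ρ →
                         ∃[ y ] ((y , wf) ∈ ρt × Before (wpref wf) y b)
  woman-improves-along e (here _) (wf∈ρ′ ∷ []) bw = woman-improves-across e bw wf∈ρ′
  woman-improves-along {wf = wf} e (step e′ p) (wf∈ρ′ ∷ wf∈vs) bw
    with x , xw , x<b ← woman-improves-across e bw wf∈ρ′
    with y , yw , y<x ← woman-improves-along e′ p wf∈vs xw
    = y , yw , Before-trans (wUniq wf) y<x x<b

  man-and-woman-paths-coincide : ∀ {ρs ρt P₁ P₂ me wf} → DPath I ρs ρt P₁ → DPath I ρs ρt P₂ →
                                 (me , wf) ∈ ρs → All (ContainsMan I me) P₁ →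
                                 All (ContainsWoman I wf) P₂ → P₁ ≡ P₂
  man-and-woman-paths-coincide (here _) (here _) _ _ _ = refl
  man-and-woman-paths-coincide {wf = wf} (here (_ , ((_ , injective) , _) , ex)) (step e p) mw _ (_ ∷ wf∈P₂)
    with y , yw , y<me ← woman-improves-along e p wf∈P₂ mw
    with refl ← injective _ _ _ (Exposed⇒matched ex yw) (Exposed⇒matched ex mw)
    = ⊥-elim (Before-irrefl (wUniq wf) y<me)
  man-and-woman-paths-coincide {me = me} (step e p) (here (_ , _ , ex)) mw (_ ∷ me∈P₁) _
    with x , mx , wf<x ← man-worsens-along e p me∈P₁ mw
    with refl ← just-injective (trans (sym (Exposed⇒matched ex mw)) (Exposed⇒matched ex mx))
    = ⊥-elim (Before-irrefl (mUniq me) wf<x)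
  man-and-woman-paths-coincide {me = me} {wf} (step e₁ p₁) (step e₂ p₂) mw (_ ∷ me∈P₁) (_ ∷ wf∈P₂)
    with x , mx , wf<x ← man-worsens-along e₁ p₁ me∈P₁ mw
    with y , yw , y<me ← woman-improves-along e₂ p₂ wf∈P₂ mw
    with rt@(_ , _ , ex) ← DPath-end p₁
    = ⊥-elim (Before-asym (mUniq me) wf<x (man-worsens ex mx
        (produced-cross (two-pairs _ rt) mx yw λ { refl → Before-irrefl (wUniq wf) y<me })))

lemma1 : ∀ {n} (I : Instance n) → InF I →
         ∀ (ρs ρt : Rot I) (P₁ P₂ : List (Rot I)) →
         DPath I ρs ρt P₁ → DPath I ρs ρt P₂ → DifferentPaths I P₁ P₂ →
         ∀ (me wf : Fin n) → (me , wf) ∈ ρs →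
         (All (ContainsMan I me) P₁ → Any (λ ρ → ¬ ContainsWoman I wf ρ) P₂)
         × (All (ContainsMan I me) P₂ → Any (λ ρ → ¬ ContainsWoman I wf ρ) P₁)
lemma1 {n} I (two-pairs , _ , _ , type1 , _) _ _ P₁ P₂ p₁ p₂ different _ wf mw =
    (λ me∈P₁ → ¬All⇒Any¬ (λ ρ → wf ∈? women I ρ) P₂ λ wf∈P₂ →
       P₁≢P₂ (man-and-woman-paths-coincide p₁ p₂ mw me∈P₁ wf∈P₂))
  , (λ me∈P₂ → ¬All⇒Any¬ (λ ρ → wf ∈? women I ρ) P₁ λ wf∈P₁ →
       P₁≢P₂ (sym (man-and-woman-paths-coincide p₂ p₁ mw me∈P₂ wf∈P₁)))
  where
    open TwoPairRotations I two-pairs type1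
    open import Data.List.Membership.DecPropositional (_≟_ {n}) using (_∈?_)
    P₁≢P₂ : P₁ ≢ P₂
    P₁≢P₂ refl = different (Pointwise.refl (0 , refl))
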